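{- Let $G$ be a connected threshold graph on $n$ vertices with binary sequence $\mathbf{b}=(b_1,\ldots,b_n)$ such that $b_{l_1}=0$ and $b_{l_1+1}=\cdots=b_n=1$ for some $l_1\in\{1,\ldots,n-1\}$. Let $l_2\in\{2,\ldots,l_1-1\}$ be such that $b_{l_2+1}=\cdots=b_{l_1}$ and $b_{l_2}\neq b_{l_2+1}$. Then the Laplacian eigenspace $\mathcal{E}_L(n-l_1)$ of $G$ is simply structured if and only if $2\leq l_2\leq \lfloor l_1/2\rfloor$.
   Context: Threshold graph: given a sequence $\mathbf{b}=(b_1,\ldots,b_n)$ of 0's and 1's with $b_1=0$, the associated threshold graph has vertices $1,\ldots,n$ added in order; when vertex $i$ is added, it is isolated if $b_i=0$, and it is joined to all vertices $j<i$ if $b_i=1$. The graph is connected iff $b_n=1$. The Laplacian matrix is $L(G)=D(G)-A(G)$; for an eigenvalue $\mu$ of $L(G)$, $\mathcal{E}_L(\mu)$ denotes the corresponding eigenspace. An eigenspace is simply structured if it admits a basis consisting of vectors whose entries all lie in $\{ -1,0,1\}$.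
   Formalization: The Laplacian eigenspace $\mathcal{E}_L(n-l_1)$ is taken over the rationals: its vectors have rational entries, and linear independence and spanning for a basis use rational coefficients. -}

module Defs where

open import Data.Nat as ℕ using (ℕ; zero; suc; _∸_; _<_; _≤_)
open import Data.Fin as Fin using (Fin; toℕ)
open import Data.Bool using (Bool; true; false; if_then_else_)
open import Data.Vec using (Vec; lookup)
open import Data.Integer using (+_)
open import Data.Rational using (ℚ; 0ℚ; 1ℚ; -_; _+_; _-_; _*_; _/_)
open import Data.Product using (Σ; _×_)
open import Data.Sum using (_⊎_)
open import Relation.Binary.PropositionalEquality using (_≡_)
open import Relation.Nullary.Decidable using (⌊_⌋; yes; no)

ℕtoℚ : ℕ → ℚ
ℕtoℚ n = (+ n) / 1

Σℚ : ∀ {k} → (Fin k → ℚ) → ℚ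
Σℚ {zero}  f = 0ℚ
Σℚ {suc k} f = f Fin.zero + Σℚ (λ i → f (Fin.suc i))

-- 1-based access to the binary sequence: bit b i = b_i for 1 ≤ i ≤ n
-- (and false outside that range; only used for indices in range).
bit : ∀ {n} → Vec Bool n → ℕ → Bool
bit {n} b zero = false
bit {n} b (suc i) with i ℕ.<? n
... | yes p = lookup b (Fin.fromℕ< p)
... | no _  = false

-- A binary sequence is a valid threshold-graph creation sequence iff b_1 = 0.
-- Vertices are Fin n (vertex Fin k corresponds to vertex k+1 of the paper).
-- Adjacency: for i < j, vertex j is joined to i iff b_j = 1 (vertex j was
-- added as dominating); no loops.
thrAdj : ∀ {n} → Vec Bool n → Fin n → Fin n → Bool
thrAdj b i j with toℕ i ℕ.<? toℕ j | toℕ j ℕ.<? toℕ i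
... | yes _ | _ = lookup b j
... | no _ | yes _ = lookup b i
... | no _ | no _ = false

adjMatrix : ∀ {n} → Vec Bool n → Fin n → Fin n → ℚ
adjMatrix b i j = if thrAdj b i j then 1ℚ else 0ℚ

degree : ∀ {n} → Vec Bool n → Fin n → ℚ
degree b i = Σℚ (adjMatrix b i)

laplacian : ∀ {n} → Vec Bool n → Fin n → Fin n → ℚ
laplacian b i j = (if ⌊ i Fin.≟ j ⌋ then degree b i else 0ℚ) - adjMatrix b i j

mulVec : ∀ {n} → (Fin n → Fin n → ℚ) → (Fin n → ℚ) → Fin n → ℚ
mulVec M x i = Σℚ (λ j → M i j * x j)

Eigenspace : ∀ {n} → (Fin n → Fin n → ℚ) → ℚ → (Fin n → ℚ) → Set
Eigenspace M μ x = ∀ i → mulVec M x i ≡ μ * x i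

linComb : ∀ {n k} → (Fin k → Fin n → ℚ) → (Fin k → ℚ) → Fin n → ℚ
linComb vs c i = Σℚ (λ a → c a * vs a i)

LinearlyIndependent : ∀ {n k} → (Fin k → Fin n → ℚ) → Set
LinearlyIndependent vs = ∀ c → (∀ i → linComb vs c i ≡ 0ℚ) → ∀ a → c a ≡ 0ℚ

IsBasisOf : ∀ {n k} → ((Fin n → ℚ) → Set) → (Fin k → Fin n → ℚ) → Set
IsBasisOf V vs =
  (∀ a → V (vs a)) × LinearlyIndependent vs ×
  (∀ x → V x → Σ (Fin _ → ℚ) λ c → ∀ i → x i ≡ linComb vs c i)

Trit : ℚ → Set
Trit q = q ≡ - 1ℚ ⊎ q ≡ 0ℚ ⊎ q ≡ 1ℚ

SimplyStructured : ∀ {n} → ((Fin n → ℚ) → Set) → Set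
SimplyStructured {n} V =
  Σ ℕ λ k → Σ (Fin k → Fin n → ℚ) λ vs →
    (∀ a i → Trit (vs a i)) × IsBasisOf V vs

{-# OPTIONS --safe #-}
-- Split the vertices into the core 1 … l₂, the block l₂+1 … l₁ and the tail l₁+1 … n:
-- the tail vertices and vertex l₂ were added dominating, the block vertices isolated.
-- The eigenspace E_L(n − l₁) consists exactly of the vectors that vanish on the tail,
-- are constant on the core and sum to 0.  Indeed every eigenvector of a nonzero Laplacian
-- eigenvalue sums to 0; a tail vertex is adjacent to all others, which forces x to vanish
-- there; and on the core x is harmonic for the induced graph, in which vertex l₂ is
-- adjacent to all others, so by the maximum principle x is constant there.  Hence the
-- block entries of such a vector sum to −l₂ times its value on the core.
--
-- If E_L(n − l₁) has a {−1,0,1}-basis, expanding the vector that is l₁ − l₂ on the core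
-- and −l₂ on the block shows that some basis vector is ±1 on the core; its l₁ − l₂ block
-- entries lie in {−1,0,1} and sum to ∓l₂, so 2l₂ ≤ l₁.  Conversely, if 2l₂ ≤ l₁, the
-- vector that is 1 on the core and −1 on the first l₂ block vertices, together with
-- e_v − e_{l₂+1} for the other block vertices v, is such a basis.
module Submission where

open import Defs
open import Data.Nat using (ℕ; zero; suc; z≤n; s≤s; _≤_; _<_; _∸_; _/_; _<ᵇ_)
import Data.Nat as ℕ
import Data.Nat.Properties as ℕ
import Data.Integer as ℤ
import Data.Integer.Properties as ℤ
open import Data.Rational using (ℚ; 0ℚ; 1ℚ; -_; _+_; _-_; _*_; 1/_; mkℚ; ↥_; ≢-nonZero)
import Data.Rational as ℚ
import Data.Rational.Properties as ℚ
import Data.Nat.Coprimality as Coprime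
import Data.Nat.DivMod as ℕ
open import Data.Fin using (Fin; toℕ; zero; suc; fromℕ<; _≟_)
import Data.Fin.Properties as Fin
open import Data.Bool using (Bool; true; false; if_then_else_; T; not)
open import Data.Bool.Properties using (¬-not)
open import Data.Vec using (Vec; lookup)
open import Algebra.Bundles using (Ring)
open import Data.Rational.Solver using (module +-*-Solver)
open +-*-Solver using (solve; _:=_; _:*_; :-_)
open import Algebra.Properties.Semiring.Sum (Ring.semiring ℚ.+-*-ring)
  using (sum; sum-cong-≗; sum-remove; sum-replicate-zero; ∑-distrib-+; ∑-comm;
         *-distribˡ-sum; *-distribʳ-sum)
open import Algebra.Properties.Ring ℚ.+-*-ring
  using (-1*x≈-x; x[y-z]≈xy-xz; [y-z]x≈yx-zx; x∙y⁻¹≈ε⇒x≈y; -‿distribʳ-*; -‿involutive;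
         +-identityʳ-unique; +-inverseʳ-unique)
open import Function using (_∘_; _⇔_; mk⇔)
open import Data.Product using (∃; _×_; _,_)
open import Data.Sum using (inj₁; inj₂)
open import Data.List using (List; allFin; filter)
open import Data.List.Relation.Unary.All as All using ()
open import Data.List.Relation.Unary.All.Properties using (all-filter)
open import Data.List.Membership.Propositional.Properties using (∈-filter⁺; ∈-allFin)
open import Relation.Binary.Bundles using (DecTotalOrder)
open import Data.List.Extrema (DecTotalOrder.totalOrder ℚ.≤-decTotalOrder)
  using (argmax; f[xs]≤f[argmax]; argmax-all)
open import Data.Vec.Functional using (removeAt)
open import Relation.Binary.PropositionalEquality
open import Relation.Binary.Definitions using (Tri; tri<; tri≈; tri>)
open import Relation.Nullary using (¬_; contradiction)
open import Relation.Nullary.Decidable using (⌊_⌋; yes; no)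
open ≡-Reasoning

ℕtoℚ-normal : ∀ m → ℕtoℚ m ≡ mkℚ (ℤ.+ m) 0 (Coprime.sym (Coprime.1-coprimeTo m))
ℕtoℚ-normal m = ℚ.↥p/↧p≡p (mkℚ (ℤ.+ m) 0 _)

ℕtoℚ-+ : ∀ m n → ℕtoℚ (m ℕ.+ n) ≡ ℕtoℚ m + ℕtoℚ n
ℕtoℚ-+ m n = begin
  ℤ.+ (m ℕ.+ n) ℚ./ 1
    ≡⟨ ℚ./-cong (cong₂ ℤ._+_ (ℤ.*-identityʳ (ℤ.+ m)) (ℤ.*-identityʳ (ℤ.+ n))) refl ⟨
  (ℤ.+ m ℤ.* ℤ.+ 1 ℤ.+ ℤ.+ n ℤ.* ℤ.+ 1) ℚ./ 1
    ≡⟨ cong₂ _+_ (ℕtoℚ-normal m) (ℕtoℚ-normal n) ⟨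
  ℕtoℚ m + ℕtoℚ n ∎

ℕtoℚ-injective : ∀ {m n} → ℕtoℚ m ≡ ℕtoℚ n → m ≡ n
ℕtoℚ-injective {m} {n} eq =
  ℤ.+-injective (cong ↥_ (trans (sym (ℕtoℚ-normal m)) (trans eq (ℕtoℚ-normal n))))

ℕtoℚ-cancel-≤ : ∀ {m n} → ℕtoℚ m ℚ.≤ ℕtoℚ n → m ≤ n
ℕtoℚ-cancel-≤ {m} {n} le rewrite ℕtoℚ-normal m | ℕtoℚ-normal n
  with ℚ.drop-*≤* le
... | le′ rewrite ℤ.*-identityʳ (ℤ.+ m) | ℤ.*-identityʳ (ℤ.+ n) = ℤ.drop‿+≤+ le′

-- Rational arithmetic

*-cancelˡ-zero : ∀ p q → p ≢ 0ℚ → p * q ≡ 0ℚ → q ≡ 0ℚ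
*-cancelˡ-zero p q p≢0 pq≡0 = begin
  q                ≡⟨ ℚ.*-identityˡ q ⟨
  1ℚ * q           ≡⟨ cong (_* q) (ℚ.*-inverseˡ p) ⟨
  (p⁻¹ * p) * q    ≡⟨ ℚ.*-assoc p⁻¹ p q ⟩
  p⁻¹ * (p * q)    ≡⟨ cong (p⁻¹ *_) pq≡0 ⟩
  p⁻¹ * 0ℚ         ≡⟨ ℚ.*-zeroʳ p⁻¹ ⟩
  0ℚ               ∎
  where
  instance
    p-nonZero : ℚ.NonZero p
    p-nonZero = ≢-nonZero p≢0
  p⁻¹ : ℚ
  p⁻¹ = 1/ p

*-cancelʳ-≢ : ∀ p q r → p * r ≡ q * r → p ≢ q → r ≡ 0ℚ
*-cancelʳ-≢ p q r pr≡qr p≢q = *-cancelˡ-zero (p - q) r (p≢q ∘ x∙y⁻¹≈ε⇒x≈y p q) (begin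
  (p - q) * r      ≡⟨ [y-z]x≈yx-zx r p q ⟩
  p * r - q * r    ≡⟨ cong (_- q * r) pr≡qr ⟩
  q * r - q * r    ≡⟨ ℚ.+-inverseʳ (q * r) ⟩
  0ℚ               ∎)

p-q+q≡p : ∀ p q → (p - q) + q ≡ p
p-q+q≡p p q = trans (ℚ.+-assoc p (- q) q) (trans (cong (p +_) (ℚ.+-inverseˡ q)) (ℚ.+-identityʳ p))

0≤p-q : ∀ {p q} → q ℚ.≤ p → 0ℚ ℚ.≤ p - q
0≤p-q {p} {q} q≤p = subst (λ s → s ℚ.≤ p - q) (ℚ.+-inverseʳ q) (ℚ.+-monoˡ-≤ (- q) q≤p)

p-q≤0⇒p≤q : ∀ {p q} → p - q ℚ.≤ 0ℚ → p ℚ.≤ q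
p-q≤0⇒p≤q {p} {q} p-q≤0 = subst₂ ℚ._≤_ (p-q+q≡p p q) (ℚ.+-identityˡ q) (ℚ.+-monoˡ-≤ q p-q≤0)

neg-cancel-≤ : ∀ {p q} → - p ℚ.≤ - q → q ℚ.≤ p
neg-cancel-≤ {p} {q} -p≤-q = subst₂ ℚ._≤_ (-‿involutive q) (-‿involutive p) (ℚ.neg-antimono-≤ -p≤-q)

indicator-weighted-nonNeg : ∀ c {q} → (T c → 0ℚ ℚ.≤ q) → 0ℚ ℚ.≤ (if c then 1ℚ else 0ℚ) * q
indicator-weighted-nonNeg true  {q} 0≤q = subst (0ℚ ℚ.≤_) (sym (ℚ.*-identityˡ q)) (0≤q _)
indicator-weighted-nonNeg false {q} _   = ℚ.≤-reflexive (sym (ℚ.*-zeroˡ q))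

Trit-square : ∀ {p} → Trit p → p ≢ 0ℚ → p * p ≡ 1ℚ
Trit-square (inj₁ refl)        _   = refl
Trit-square (inj₂ (inj₁ refl)) p≢0 = contradiction refl p≢0
Trit-square (inj₂ (inj₂ refl)) _   = refl

neg-Trit-product≤1 : ∀ {p q} → Trit p → Trit q → - (p * q) ℚ.≤ 1ℚ
neg-Trit-product≤1 (inj₁ refl)        (inj₁ refl)        = ℚ.≤ᵇ⇒≤ _
neg-Trit-product≤1 (inj₁ refl)        (inj₂ (inj₁ refl)) = ℚ.≤ᵇ⇒≤ _
neg-Trit-product≤1 (inj₁ refl)        (inj₂ (inj₂ refl)) = ℚ.≤ᵇ⇒≤ _
neg-Trit-product≤1 (inj₂ (inj₁ refl)) (inj₁ refl)        = ℚ.≤ᵇ⇒≤ _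
neg-Trit-product≤1 (inj₂ (inj₁ refl)) (inj₂ (inj₁ refl)) = ℚ.≤ᵇ⇒≤ _
neg-Trit-product≤1 (inj₂ (inj₁ refl)) (inj₂ (inj₂ refl)) = ℚ.≤ᵇ⇒≤ _
neg-Trit-product≤1 (inj₂ (inj₂ refl)) (inj₁ refl)        = ℚ.≤ᵇ⇒≤ _
neg-Trit-product≤1 (inj₂ (inj₂ refl)) (inj₂ (inj₁ refl)) = ℚ.≤ᵇ⇒≤ _
neg-Trit-product≤1 (inj₂ (inj₂ refl)) (inj₂ (inj₂ refl)) = ℚ.≤ᵇ⇒≤ _

-- Finite sums and indicator vectors

Σℚ≡sum : ∀ {k} (f : Fin k → ℚ) → Σℚ f ≡ sum f
Σℚ≡sum {zero}  f = refl
Σℚ≡sum {suc k} f = cong (f zero +_) (Σℚ≡sum (f ∘ suc))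

Σ-cong : ∀ {k} {f g : Fin k → ℚ} → (∀ a → f a ≡ g a) → Σℚ f ≡ Σℚ g
Σ-cong {f = f} {g} f≗g = trans (Σℚ≡sum f) (trans (sum-cong-≗ f≗g) (sym (Σℚ≡sum g)))

Σ-zero : ∀ k → Σℚ {k} (λ _ → 0ℚ) ≡ 0ℚ
Σ-zero k = trans (Σℚ≡sum {k} (λ _ → 0ℚ)) (sum-replicate-zero k)

Σ-+ : ∀ {k} (f g : Fin k → ℚ) → Σℚ (λ a → f a + g a) ≡ Σℚ f + Σℚ g
Σ-+ f g = begin
  Σℚ (λ a → f a + g a) ≡⟨ Σℚ≡sum (λ a → f a + g a) ⟩
  sum (λ a → f a + g a) ≡⟨ ∑-distrib-+ f g ⟩
  sum f + sum g         ≡⟨ cong₂ _+_ (Σℚ≡sum f) (Σℚ≡sum g) ⟨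
  Σℚ f + Σℚ g           ∎

Σ-*ˡ : ∀ {k} c (f : Fin k → ℚ) → Σℚ (λ a → c * f a) ≡ c * Σℚ f
Σ-*ˡ c f = trans (Σℚ≡sum (λ a → c * f a)) (trans (sym (*-distribˡ-sum c f)) (cong (c *_) (sym (Σℚ≡sum f))))

Σ-*ʳ : ∀ {k} c (f : Fin k → ℚ) → Σℚ (λ a → f a * c) ≡ Σℚ f * c
Σ-*ʳ c f = trans (Σℚ≡sum (λ a → f a * c)) (trans (sym (*-distribʳ-sum c f)) (cong (_* c) (sym (Σℚ≡sum f))))

Σ-neg : ∀ {k} (f : Fin k → ℚ) → Σℚ (λ a → - f a) ≡ - Σℚ f
Σ-neg f = begin
  Σℚ (λ a → - f a)      ≡⟨ Σ-cong (λ a → -1*x≈-x (f a)) ⟨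
  Σℚ (λ a → - 1ℚ * f a) ≡⟨ Σ-*ˡ (- 1ℚ) f ⟩
  - 1ℚ * Σℚ f           ≡⟨ -1*x≈-x (Σℚ f) ⟩
  - Σℚ f                ∎

Σ-− : ∀ {k} (f g : Fin k → ℚ) → Σℚ (λ a → f a - g a) ≡ Σℚ f - Σℚ g
Σ-− f g = trans (Σ-+ f (λ a → - g a)) (cong (Σℚ f +_) (Σ-neg g))

Σ-comm : ∀ {k m} (f : Fin k → Fin m → ℚ) →
         Σℚ (λ a → Σℚ (f a)) ≡ Σℚ (λ b → Σℚ (λ a → f a b))
Σ-comm f = begin
  Σℚ (λ a → Σℚ (f a))           ≡⟨ Σ-cong (λ a → Σℚ≡sum (f a)) ⟩
  Σℚ (λ a → sum (f a))          ≡⟨ Σℚ≡sum (λ a → sum (f a)) ⟩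
  sum (λ a → sum (f a))         ≡⟨ ∑-comm f ⟩
  sum (λ b → sum (λ a → f a b)) ≡⟨ Σℚ≡sum (λ b → sum (λ a → f a b)) ⟨
  Σℚ (λ b → sum (λ a → f a b))  ≡⟨ Σ-cong (λ b → Σℚ≡sum (λ a → f a b)) ⟨
  Σℚ (λ b → Σℚ (λ a → f a b))   ∎

Σ-single : ∀ {k} (f : Fin k → ℚ) (v : Fin k) → (∀ a → a ≢ v → f a ≡ 0ℚ) → Σℚ f ≡ f v
Σ-single {suc k} f v off-v = begin
  Σℚ f                      ≡⟨ Σℚ≡sum f ⟩
  sum f                     ≡⟨ sum-remove f ⟩
  f v + sum (removeAt f v)  ≡⟨ cong (f v +_) (sum-cong-≗ {y = λ _ → 0ℚ} (λ a → off-v _ (Fin.punchInᵢ≢i v a))) ⟩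
  f v + sum {k} (λ _ → 0ℚ)  ≡⟨ cong (f v +_) (sum-replicate-zero k) ⟩
  f v + 0ℚ                  ≡⟨ ℚ.+-identityʳ (f v) ⟩
  f v                       ∎

Σ-mono-≤ : ∀ {k} {f g : Fin k → ℚ} → (∀ a → f a ℚ.≤ g a) → Σℚ f ℚ.≤ Σℚ g
Σ-mono-≤ {zero}  _   = ℚ.≤-refl
Σ-mono-≤ {suc k} f≤g = ℚ.+-mono-≤ (f≤g zero) (Σ-mono-≤ (f≤g ∘ suc))

Σ-nonNeg : ∀ {k} (f : Fin k → ℚ) → (∀ a → 0ℚ ℚ.≤ f a) → 0ℚ ℚ.≤ Σℚ f
Σ-nonNeg {k} f 0≤f = subst (λ s → s ℚ.≤ Σℚ f) (Σ-zero k) (Σ-mono-≤ 0≤f)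

term≤Σ : ∀ {k} (f : Fin k → ℚ) → (∀ a → 0ℚ ℚ.≤ f a) → ∀ a → f a ℚ.≤ Σℚ f
term≤Σ f 0≤f zero    = ℚ.≤-trans (ℚ.≤-reflexive (sym (ℚ.+-identityʳ (f zero))))
                         (ℚ.+-monoʳ-≤ (f zero) (Σ-nonNeg (f ∘ suc) (0≤f ∘ suc)))
term≤Σ f 0≤f (suc a) = ℚ.≤-trans (term≤Σ (f ∘ suc) (0≤f ∘ suc) a)
                         (ℚ.≤-trans (ℚ.≤-reflexive (sym (ℚ.+-identityˡ _)))
                           (ℚ.+-monoˡ-≤ (Σℚ (f ∘ suc)) (0≤f zero)))

below atLeast : ℕ → ℕ → ℚ
below   l t = if t <ᵇ l then 1ℚ else 0ℚ
atLeast l t = if t <ᵇ l then 0ℚ else 1ℚ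

below-< : ∀ {l t} → t < l → below l t ≡ 1ℚ
below-< {suc l} {zero}  _         = refl
below-< {suc l} {suc t} (s≤s t<l) = below-< t<l

below-≥ : ∀ {l t} → l ≤ t → below l t ≡ 0ℚ
below-≥ {zero}  _         = refl
below-≥ {suc l} (s≤s l≤t) = below-≥ l≤t

atLeast-< : ∀ {l t} → t < l → atLeast l t ≡ 0ℚ
atLeast-< {suc l} {zero}  _         = refl
atLeast-< {suc l} {suc t} (s≤s t<l) = atLeast-< t<l

atLeast-≥ : ∀ {l t} → l ≤ t → atLeast l t ≡ 1ℚ
atLeast-≥ {zero}  _         = refl
atLeast-≥ {suc l} (s≤s l≤t) = atLeast-≥ l≤t

Σ-below : ∀ {n l} → l ≤ n → Σℚ {n} (λ j → below l (toℕ j)) ≡ ℕtoℚ l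
Σ-below {n}     {zero}  _         = Σ-zero n
Σ-below {suc n} {suc l} (s≤s l≤n) = trans (cong (1ℚ +_) (Σ-below l≤n)) (sym (ℕtoℚ-+ 1 l))

Σ-atLeast : ∀ {n} l → Σℚ {n} (λ j → atLeast l (toℕ j)) ≡ ℕtoℚ (n ∸ l)
Σ-atLeast {zero}  l       = cong ℕtoℚ (sym (ℕ.0∸n≡0 l))
Σ-atLeast {suc n} zero    = trans (cong (1ℚ +_) (Σ-atLeast {n} 0)) (sym (ℕtoℚ-+ 1 n))
Σ-atLeast {suc n} (suc l) = trans (ℚ.+-identityˡ _) (Σ-atLeast {n} l)

Σ-const : ∀ {n} c → Σℚ {n} (λ _ → c) ≡ ℕtoℚ n * c
Σ-const {n} c = begin
  Σℚ {n} (λ _ → c)      ≡⟨ Σ-cong {n} (λ _ → ℚ.*-identityˡ c) ⟨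
  Σℚ {n} (λ _ → 1ℚ * c) ≡⟨ Σ-*ʳ c (λ (_ : Fin n) → 1ℚ) ⟩
  Σℚ {n} (λ _ → 1ℚ) * c ≡⟨ cong (_* c) (Σ-atLeast {n} 0) ⟩
  ℕtoℚ n * c            ∎

unit : ∀ {n} → Fin n → Fin n → ℚ
unit v j = if ⌊ v ≟ j ⌋ then 1ℚ else 0ℚ

unit-≡ : ∀ {n} (v : Fin n) → unit v v ≡ 1ℚ
unit-≡ v with v ≟ v
... | yes _   = refl
... | no v≢v  = contradiction refl v≢v

unit-≢ : ∀ {n} {v j : Fin n} → v ≢ j → unit v j ≡ 0ℚ
unit-≢ {v = v} {j} v≢j with v ≟ j
... | yes v≡j = contradiction v≡j v≢j
... | no _    = refl

Σ-unit : ∀ {n} (v : Fin n) → Σℚ (unit v) ≡ 1ℚ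
Σ-unit v = trans (Σ-single (unit v) v (λ j j≢v → unit-≢ (j≢v ∘ sym))) (unit-≡ v)

Trit-unit-difference : ∀ {n} (u v j : Fin n) → Trit (unit u j - unit v j)
Trit-unit-difference u v j with u ≟ j | v ≟ j
... | yes _ | yes _ = inj₂ (inj₁ refl)
... | yes _ | no _  = inj₂ (inj₂ refl)
... | no _  | yes _ = inj₁ refl
... | no _  | no _  = inj₂ (inj₁ refl)

-- The Laplacian of a threshold graph

thrAdj-< : ∀ {n} (b : Vec Bool n) {i j : Fin n} → toℕ i < toℕ j → thrAdj b i j ≡ lookup b j
thrAdj-< b {i} {j} i<j with toℕ i ℕ.<? toℕ j
... | yes _   = refl
... | no i≮j  = contradiction i<j i≮j

thrAdj-self : ∀ {n} (b : Vec Bool n) (i : Fin n) → thrAdj b i i ≡ false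
thrAdj-self b i with toℕ i ℕ.<? toℕ i
... | yes i<i = contradiction i<i (ℕ.<-irrefl refl)
... | no _    = refl

thrAdj-sym : ∀ {n} (b : Vec Bool n) (i j : Fin n) → thrAdj b i j ≡ thrAdj b j i
thrAdj-sym b i j with toℕ i ℕ.<? toℕ j | toℕ j ℕ.<? toℕ i
... | yes i<j | yes j<i = contradiction j<i (ℕ.<-asym i<j)
... | yes _   | no _    = refl
... | no _    | yes _   = refl
... | no _    | no _    = refl

adjMatrix-sym : ∀ {n} (b : Vec Bool n) (i j : Fin n) → adjMatrix b i j ≡ adjMatrix b j i
adjMatrix-sym b i j = cong (if_then 1ℚ else 0ℚ) (thrAdj-sym b i j)

Σ-diagonal : ∀ {n} (i : Fin n) d (x : Fin n → ℚ) →
             Σℚ (λ j → (if ⌊ i ≟ j ⌋ then d else 0ℚ) * x j) ≡ d * x i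
Σ-diagonal i d x = trans (Σ-single _ i off-diagonal) on-diagonal
  where
  off-diagonal : ∀ j → j ≢ i → (if ⌊ i ≟ j ⌋ then d else 0ℚ) * x j ≡ 0ℚ
  off-diagonal j j≢i with i ≟ j
  ... | yes i≡j = contradiction (sym i≡j) j≢i
  ... | no _    = ℚ.*-zeroˡ (x j)
  on-diagonal : (if ⌊ i ≟ i ⌋ then d else 0ℚ) * x i ≡ d * x i
  on-diagonal with i ≟ i
  ... | yes _   = refl
  ... | no i≢i  = contradiction refl i≢i

laplacian-row : ∀ {n} (b : Vec Bool n) (x : Fin n → ℚ) (i : Fin n) →
                mulVec (laplacian b) x i ≡ Σℚ (λ j → adjMatrix b i j * (x i - x j))
laplacian-row {n} b x i = begin
  Σℚ (λ j → (D j - A j) * x j)                 ≡⟨ Σ-cong (λ j → [y-z]x≈yx-zx (x j) (D j) (A j)) ⟩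
  Σℚ (λ j → D j * x j - A j * x j)             ≡⟨ Σ-− (λ j → D j * x j) (λ j → A j * x j) ⟩
  Σℚ (λ j → D j * x j) - Σℚ (λ j → A j * x j)  ≡⟨ cong (_- Σℚ (λ j → A j * x j)) (Σ-diagonal i (degree b i) x) ⟩
  degree b i * x i - Σℚ (λ j → A j * x j)      ≡⟨ cong (_- Σℚ (λ j → A j * x j)) (Σ-*ʳ (x i) A) ⟨
  Σℚ (λ j → A j * x i) - Σℚ (λ j → A j * x j)  ≡⟨ Σ-− (λ j → A j * x i) (λ j → A j * x j) ⟨
  Σℚ (λ j → A j * x i - A j * x j)             ≡⟨ Σ-cong (λ j → x[y-z]≈xy-xz (A j) (x i) (x j)) ⟨
  Σℚ (λ j → A j * (x i - x j))                 ∎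
  where
  A D : Fin n → ℚ
  A j = adjMatrix b i j
  D j = if ⌊ i ≟ j ⌋ then degree b i else 0ℚ

Σ-laplacian : ∀ {n} (b : Vec Bool n) (x : Fin n → ℚ) → Σℚ (mulVec (laplacian b) x) ≡ 0ℚ
Σ-laplacian {n} b x = begin
  Σℚ (mulVec (laplacian b) x)                               ≡⟨ Σ-cong (laplacian-row b x) ⟩
  Σℚ (λ i → Σℚ (λ j → adjMatrix b i j * (x i - x j)))       ≡⟨ Σ-cong (λ i → Σ-cong (λ j → antisymmetric i j)) ⟩
  Σℚ (λ i → Σℚ (λ j → flow i j - flow j i))                 ≡⟨ Σ-cong (λ i → Σ-− (flow i) (λ j → flow j i)) ⟩
  Σℚ (λ i → Σℚ (flow i) - Σℚ (λ j → flow j i))              ≡⟨ Σ-− (λ i → Σℚ (flow i)) (λ i → Σℚ (λ j → flow j i)) ⟩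
  Σℚ (λ i → Σℚ (flow i)) - Σℚ (λ i → Σℚ (λ j → flow j i))   ≡⟨ cong (λ s → Σℚ (λ i → Σℚ (flow i)) - s) (Σ-comm flow) ⟨
  Σℚ (λ i → Σℚ (flow i)) - Σℚ (λ i → Σℚ (flow i))           ≡⟨ ℚ.+-inverseʳ (Σℚ (λ i → Σℚ (flow i))) ⟩
  0ℚ                                                        ∎
  where
  flow : Fin n → Fin n → ℚ
  flow i j = adjMatrix b i j * x i
  antisymmetric : ∀ i j → adjMatrix b i j * (x i - x j) ≡ flow i j - flow j i
  antisymmetric i j = trans (x[y-z]≈xy-xz (adjMatrix b i j) (x i) (x j))
    (cong (λ a → flow i j - a * x j) (adjMatrix-sym b i j))

eigenvector-sum≡0 : ∀ {n} (b : Vec Bool n) {μ} {x : Fin n → ℚ} → μ ≢ 0ℚ →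
                    Eigenspace (laplacian b) μ x → Σℚ x ≡ 0ℚ
eigenvector-sum≡0 b {μ} {x} μ≢0 eig = *-cancelˡ-zero μ (Σℚ x) μ≢0 (begin
  μ * Σℚ x                     ≡⟨ Σ-*ˡ μ x ⟨
  Σℚ (λ i → μ * x i)           ≡⟨ Σ-cong eig ⟨
  Σℚ (mulVec (laplacian b) x)  ≡⟨ Σ-laplacian b x ⟩
  0ℚ                           ∎)

-- The eigenspace E_L(n − l₁)

-- The hypotheses, 0-based: vertex j : Fin n is the paper's vertex toℕ j + 1, so the core
-- is toℕ j < l₂, the block l₂ ≤ toℕ j < l₁, the tail l₁ ≤ toℕ j, and the hub is the
-- paper's vertex l₂.
record ThresholdShape {n} (b : Vec Bool n) (l₁ l₂ : ℕ) : Set where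
  field
    0<l₂            : 0 < l₂
    l₂<l₁           : l₂ < l₁
    l₁<n            : l₁ < n
    hub-dominating  : ∀ j → suc (toℕ j) ≡ l₂ → lookup b j ≡ true
    block-isolated  : ∀ j → l₂ ≤ toℕ j → toℕ j < l₁ → lookup b j ≡ false
    tail-dominating : ∀ j → l₁ ≤ toℕ j → lookup b j ≡ true

module _ {n} {b : Vec Bool n} {l₁ l₂} (shape : ThresholdShape b l₁ l₂) where
  open ThresholdShape shape

  μ : ℚ
  μ = ℕtoℚ (n ∸ l₁)

  l₂<n : l₂ < n
  l₂<n = ℕ.<-trans l₂<l₁ l₁<n

  hub : Fin n
  hub = fromℕ< (ℕ.≤-<-trans (ℕ.m∸n≤m l₂ 1) l₂<n)

  suc-hub : suc (toℕ hub) ≡ l₂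
  suc-hub = trans (cong suc (Fin.toℕ-fromℕ< _)) (ℕ.suc-pred l₂ {{ℕ.>-nonZero 0<l₂}})

  hub<l₂ : toℕ hub < l₂
  hub<l₂ = ℕ.≤-reflexive suc-hub

  data Region (j : Fin n) : Set where
    core  : toℕ j < l₂ → Region j
    block : l₂ ≤ toℕ j → toℕ j < l₁ → Region j
    tail  : l₁ ≤ toℕ j → Region j

  region : ∀ j → Region j
  region j with toℕ j ℕ.<? l₂ | toℕ j ℕ.<? l₁
  ... | yes j<l₂ | _        = core j<l₂
  ... | no j≮l₂  | yes j<l₁ = block (ℕ.≮⇒≥ j≮l₂) j<l₁
  ... | no _     | no j≮l₁  = tail (ℕ.≮⇒≥ j≮l₁)

  χ-core χ-front χ-block χ-tail : Fin n → ℚ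
  χ-core  j = below l₂ (toℕ j)
  χ-front j = below l₁ (toℕ j)
  χ-block j = χ-front j - χ-core j
  χ-tail  j = atLeast l₁ (toℕ j)

  χ-block-core : ∀ {j} → toℕ j < l₂ → χ-block j ≡ 0ℚ
  χ-block-core j<l₂ = cong₂ _-_ (below-< (ℕ.<-trans j<l₂ l₂<l₁)) (below-< j<l₂)

  χ-block-block : ∀ {j} → l₂ ≤ toℕ j → toℕ j < l₁ → χ-block j ≡ 1ℚ
  χ-block-block l₂≤j j<l₁ = cong₂ _-_ (below-< j<l₁) (below-≥ l₂≤j)

  χ-block-tail : ∀ {j} → l₁ ≤ toℕ j → χ-block j ≡ 0ℚ
  χ-block-tail l₁≤j = cong₂ _-_ (below-≥ l₁≤j) (below-≥ (ℕ.≤-trans (ℕ.<⇒≤ l₂<l₁) l₁≤j))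

  tail-adjacent : ∀ {i j} → toℕ i ≢ toℕ j → l₁ ≤ toℕ j → adjMatrix b i j ≡ 1ℚ
  tail-adjacent {i} {j} i≢j l₁≤j = cong (if_then 1ℚ else 0ℚ) (adjacent (ℕ.<-cmp (toℕ i) (toℕ j)))
    where
    adjacent : Tri (toℕ i < toℕ j) (toℕ i ≡ toℕ j) (toℕ j < toℕ i) → thrAdj b i j ≡ true
    adjacent (tri< i<j _ _) = trans (thrAdj-< b i<j) (tail-dominating j l₁≤j)
    adjacent (tri≈ _ i≡j _) = contradiction i≡j i≢j
    adjacent (tri> _ _ j<i) = trans (thrAdj-sym b i j)
      (trans (thrAdj-< b j<i) (tail-dominating i (ℕ.≤-trans l₁≤j (ℕ.<⇒≤ j<i))))

  block-nonadjacent : ∀ {i j} → toℕ i < l₁ → l₂ ≤ toℕ j → toℕ j < l₁ → adjMatrix b i j ≡ 0ℚ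
  block-nonadjacent {i} {j} i<l₁ l₂≤j j<l₁ =
    cong (if_then 1ℚ else 0ℚ) (nonadjacent (ℕ.<-cmp (toℕ i) (toℕ j)))
    where
    nonadjacent : Tri (toℕ i < toℕ j) (toℕ i ≡ toℕ j) (toℕ j < toℕ i) → thrAdj b i j ≡ false
    nonadjacent (tri< i<j _ _) = trans (thrAdj-< b i<j) (block-isolated j l₂≤j j<l₁)
    nonadjacent (tri≈ _ i≡j _) rewrite Fin.toℕ-injective i≡j = thrAdj-self b j
    nonadjacent (tri> _ _ j<i) = trans (thrAdj-sym b i j)
      (trans (thrAdj-< b j<i) (block-isolated i (ℕ.≤-trans l₂≤j (ℕ.<⇒≤ j<i)) i<l₁))

  hub-adjacent : ∀ {i} → toℕ i < toℕ hub → adjMatrix b i hub ≡ 1ℚ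
  hub-adjacent i<hub = cong (if_then 1ℚ else 0ℚ) (trans (thrAdj-< b i<hub) (hub-dominating hub suc-hub))

  edge-beyond-core : ∀ {x : Fin n → ℚ} → (∀ j → l₁ ≤ toℕ j → x j ≡ 0ℚ) → ∀ {i j} → toℕ i < l₁ → l₂ ≤ toℕ j →
                     adjMatrix b i j * (x i - x j) ≡ χ-tail j * x i
  edge-beyond-core {x} vanish {i} {j} i<l₁ l₂≤j with toℕ j ℕ.<? l₁
  ... | yes j<l₁ = begin
    adjMatrix b i j * (x i - x j)  ≡⟨ cong (_* (x i - x j)) (block-nonadjacent i<l₁ l₂≤j j<l₁) ⟩
    0ℚ * (x i - x j)               ≡⟨ ℚ.*-zeroˡ (x i - x j) ⟩
    0ℚ                             ≡⟨ ℚ.*-zeroˡ (x i) ⟨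
    0ℚ * x i                       ≡⟨ cong (_* x i) (atLeast-< j<l₁) ⟨
    χ-tail j * x i                 ∎
  ... | no j≮l₁ = begin
    adjMatrix b i j * (x i - x j)  ≡⟨ cong₂ (λ a q → a * (x i - q)) (tail-adjacent i≢j l₁≤j) (vanish j l₁≤j) ⟩
    1ℚ * (x i - 0ℚ)                ≡⟨ cong (1ℚ *_) (ℚ.+-identityʳ (x i)) ⟩
    1ℚ * x i                       ≡⟨ cong (_* x i) (atLeast-≥ l₁≤j) ⟨
    χ-tail j * x i                 ∎
    where
    l₁≤j : l₁ ≤ toℕ j
    l₁≤j = ℕ.≮⇒≥ j≮l₁
    i≢j : toℕ i ≢ toℕ j
    i≢j = ℕ.<⇒≢ (ℕ.<-≤-trans i<l₁ l₁≤j)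

  coreLaplacian : (Fin n → ℚ) → Fin n → ℚ
  coreLaplacian x i = Σℚ (λ j → χ-core j * (adjMatrix b i j * (x i - x j)))

  coreLaplacian-neg : ∀ x i → coreLaplacian (λ j → - x j) i ≡ - coreLaplacian x i
  coreLaplacian-neg x i = trans (Σ-cong negate) (Σ-neg (λ j → χ-core j * edge j))
    where
    edge : Fin n → ℚ
    edge j = adjMatrix b i j * (x i - x j)
    negate : ∀ j → χ-core j * (adjMatrix b i j * (- x i - - x j)) ≡ - (χ-core j * edge j)
    negate j = begin
      χ-core j * (adjMatrix b i j * (- x i - - x j))  ≡⟨ cong (λ d → χ-core j * (adjMatrix b i j * d))
                                                            (ℚ.neg-distrib-+ (x i) (- x j)) ⟨
      χ-core j * (adjMatrix b i j * - (x i - x j))    ≡⟨ cong (χ-core j *_) (-‿distribʳ-* (adjMatrix b i j) _) ⟨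
      χ-core j * - edge j                             ≡⟨ -‿distribʳ-* (χ-core j) (edge j) ⟨
      - (χ-core j * edge j)                           ∎

  front-row : ∀ {x : Fin n → ℚ} → (∀ j → l₁ ≤ toℕ j → x j ≡ 0ℚ) → ∀ {i} → toℕ i < l₁ →
              Σℚ (λ j → adjMatrix b i j * (x i - x j)) ≡ μ * x i + coreLaplacian x i
  front-row {x} vanish {i} i<l₁ = begin
    Σℚ edge                                        ≡⟨ Σ-cong split ⟩
    Σℚ (λ j → χ-tail j * x i + χ-core j * edge j)  ≡⟨ Σ-+ (λ j → χ-tail j * x i) (λ j → χ-core j * edge j) ⟩
    Σℚ (λ j → χ-tail j * x i) + coreLaplacian x i  ≡⟨ cong (_+ coreLaplacian x i) (Σ-*ʳ (x i) χ-tail) ⟩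
    Σℚ χ-tail * x i + coreLaplacian x i            ≡⟨ cong (λ s → s * x i + coreLaplacian x i) (Σ-atLeast l₁) ⟩
    μ * x i + coreLaplacian x i                    ∎
    where
    edge : Fin n → ℚ
    edge j = adjMatrix b i j * (x i - x j)
    split : ∀ j → edge j ≡ χ-tail j * x i + χ-core j * edge j
    split j with toℕ j ℕ.<? l₂
    ... | yes j<l₂ = sym (begin
      χ-tail j * x i + χ-core j * edge j  ≡⟨ cong₂ (λ t c → t * x i + c * edge j)
                                               (atLeast-< (ℕ.<-trans j<l₂ l₂<l₁)) (below-< j<l₂) ⟩
      0ℚ * x i + 1ℚ * edge j              ≡⟨ cong₂ _+_ (ℚ.*-zeroˡ (x i)) (ℚ.*-identityˡ (edge j)) ⟩
      0ℚ + edge j                         ≡⟨ ℚ.+-identityˡ (edge j) ⟩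
      edge j                              ∎)
    ... | no j≮l₂ = begin
      edge j                              ≡⟨ edge-beyond-core vanish i<l₁ (ℕ.≮⇒≥ j≮l₂) ⟩
      χ-tail j * x i                      ≡⟨ ℚ.+-identityʳ (χ-tail j * x i) ⟨
      χ-tail j * x i + 0ℚ                 ≡⟨ cong (χ-tail j * x i +_) (ℚ.*-zeroˡ (edge j)) ⟨
      χ-tail j * x i + 0ℚ * edge j        ≡⟨ cong (λ c → χ-tail j * x i + c * edge j) (below-≥ (ℕ.≮⇒≥ j≮l₂)) ⟨
      χ-tail j * x i + χ-core j * edge j  ∎

  tail-row : ∀ (x : Fin n → ℚ) {i} → l₁ ≤ toℕ i →
             Σℚ (λ j → adjMatrix b i j * (x i - x j)) ≡ ℕtoℚ n * x i - Σℚ x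
  tail-row x {i} l₁≤i = begin
    Σℚ (λ j → adjMatrix b i j * (x i - x j))  ≡⟨ Σ-cong edge ⟩
    Σℚ (λ j → x i - x j)                      ≡⟨ Σ-− (λ _ → x i) x ⟩
    Σℚ {n} (λ _ → x i) - Σℚ x                 ≡⟨ cong (_- Σℚ x) (Σ-const {n} (x i)) ⟩
    ℕtoℚ n * x i - Σℚ x                       ∎
    where
    edge : ∀ j → adjMatrix b i j * (x i - x j) ≡ x i - x j
    edge j with toℕ i ℕ.≟ toℕ j
    ... | yes i≡j rewrite Fin.toℕ-injective i≡j = begin
      adjMatrix b j j * (x j - x j)  ≡⟨ cong (adjMatrix b j j *_) (ℚ.+-inverseʳ (x j)) ⟩
      adjMatrix b j j * 0ℚ           ≡⟨ ℚ.*-zeroʳ (adjMatrix b j j) ⟩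
      0ℚ                             ≡⟨ ℚ.+-inverseʳ (x j) ⟨
      x j - x j                      ∎
    ... | no i≢j = trans (cong (_* (x i - x j)) (trans (adjMatrix-sym b i j) (tail-adjacent (i≢j ∘ sym) l₁≤i)))
                         (ℚ.*-identityˡ (x i - x j))

  -- E_L(n − l₁) turns out to be exactly the set of admissible vectors.
  record Admissible (x : Fin n → ℚ) : Set where
    field
      vanishes-on-tail : ∀ j → l₁ ≤ toℕ j → x j ≡ 0ℚ
      constant-on-core : ∀ j → toℕ j < l₂ → x j ≡ x hub
      sum≡0            : Σℚ x ≡ 0ℚ

  edge-into-core : ∀ {x} → Admissible x → ∀ {i j} → toℕ i < l₁ → toℕ j < l₂ →
                   adjMatrix b i j * (x i - x j) ≡ 0ℚ
  edge-into-core {x} adm {i} {j} i<l₁ j<l₂ with region i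
  ... | core i<l₂ = begin
    adjMatrix b i j * (x i - x j)      ≡⟨ cong₂ (λ p q → adjMatrix b i j * (p - q)) (const i i<l₂) (const j j<l₂) ⟩
    adjMatrix b i j * (x hub - x hub)  ≡⟨ cong (adjMatrix b i j *_) (ℚ.+-inverseʳ (x hub)) ⟩
    adjMatrix b i j * 0ℚ               ≡⟨ ℚ.*-zeroʳ (adjMatrix b i j) ⟩
    0ℚ                                 ∎
    where
    const : ∀ j → toℕ j < l₂ → x j ≡ x hub
    const = Admissible.constant-on-core adm
  ... | block l₂≤i _ = trans (cong (_* (x i - x j)) (trans (adjMatrix-sym b i j)
                         (block-nonadjacent (ℕ.<-trans j<l₂ l₂<l₁) l₂≤i i<l₁))) (ℚ.*-zeroˡ (x i - x j))
  ... | tail l₁≤i = contradiction i<l₁ (ℕ.≤⇒≯ l₁≤i)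

  admissible⇒eigen : ∀ {x} → Admissible x → Eigenspace (laplacian b) μ x
  admissible⇒eigen {x} adm i with toℕ i ℕ.<? l₁
  ... | yes i<l₁ = begin
    mulVec (laplacian b) x i                                         ≡⟨ laplacian-row b x i ⟩
    Σℚ (λ j → adjMatrix b i j * (x i - x j))                         ≡⟨ front-row vanish i<l₁ ⟩
    μ * x i + coreLaplacian x i                ≡⟨ cong (μ * x i +_) (trans (Σ-cong core-term) (Σ-zero n)) ⟩
    μ * x i + 0ℚ                               ≡⟨ ℚ.+-identityʳ (μ * x i) ⟩
    μ * x i                                    ∎
    where
    vanish : ∀ j → l₁ ≤ toℕ j → x j ≡ 0ℚ
    vanish = Admissible.vanishes-on-tail adm
    core-term : ∀ j → χ-core j * (adjMatrix b i j * (x i - x j)) ≡ 0ℚ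
    core-term j with toℕ j ℕ.<? l₂
    ... | yes j<l₂ = trans (cong (χ-core j *_) (edge-into-core adm i<l₁ j<l₂)) (ℚ.*-zeroʳ (χ-core j))
    ... | no j≮l₂  = trans (cong (_* (adjMatrix b i j * (x i - x j))) (below-≥ (ℕ.≮⇒≥ j≮l₂)))
                           (ℚ.*-zeroˡ (adjMatrix b i j * (x i - x j)))
  ... | no i≮l₁ = begin
    mulVec (laplacian b) x i                  ≡⟨ laplacian-row b x i ⟩
    Σℚ (λ j → adjMatrix b i j * (x i - x j))  ≡⟨ tail-row x l₁≤i ⟩
    ℕtoℚ n * x i - Σℚ x                       ≡⟨ cong₂ (λ p s → ℕtoℚ n * p - s) xᵢ≡0 (Admissible.sum≡0 adm) ⟩
    ℕtoℚ n * 0ℚ - 0ℚ                          ≡⟨ cong (_- 0ℚ) (ℚ.*-zeroʳ (ℕtoℚ n)) ⟩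
    0ℚ                                        ≡⟨ ℚ.*-zeroʳ μ ⟨
    μ * 0ℚ                                    ≡⟨ cong (μ *_) xᵢ≡0 ⟨
    μ * x i                                   ∎
    where
    l₁≤i : l₁ ≤ toℕ i
    l₁≤i = ℕ.≮⇒≥ i≮l₁
    xᵢ≡0 : x i ≡ 0ℚ
    xᵢ≡0 = Admissible.vanishes-on-tail adm i l₁≤i

  μ≢0 : μ ≢ 0ℚ
  μ≢0 μ≡0 = ℕ.<⇒≢ (ℕ.m<n⇒0<n∸m l₁<n) (sym (ℕtoℚ-injective μ≡0))

  eigen-vanishes-on-tail : ∀ {x} → Eigenspace (laplacian b) μ x → ∀ i → l₁ ≤ toℕ i → x i ≡ 0ℚ
  eigen-vanishes-on-tail {x} eig i l₁≤i = *-cancelʳ-≢ (ℕtoℚ n) μ (x i) (begin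
    ℕtoℚ n * x i                              ≡⟨ ℚ.+-identityʳ (ℕtoℚ n * x i) ⟨
    ℕtoℚ n * x i - 0ℚ                         ≡⟨ cong (λ s → ℕtoℚ n * x i - s) (eigenvector-sum≡0 b μ≢0 eig) ⟨
    ℕtoℚ n * x i - Σℚ x                       ≡⟨ tail-row x l₁≤i ⟨
    Σℚ (λ j → adjMatrix b i j * (x i - x j))  ≡⟨ laplacian-row b x i ⟨
    mulVec (laplacian b) x i                  ≡⟨ eig i ⟩
    μ * x i                                   ∎) n≢μ
    where
    n≢μ : ℕtoℚ n ≢ μ
    n≢μ = ℕ.<⇒≢ (ℕ.∸-monoʳ-< (ℕ.≤-<-trans z≤n l₂<l₁) (ℕ.<⇒≤ l₁<n)) ∘ sym ∘ ℕtoℚ-injective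

  CoreHarmonic : (Fin n → ℚ) → Set
  CoreHarmonic x = ∀ i → toℕ i < l₂ → coreLaplacian x i ≡ 0ℚ

  eigen⇒coreHarmonic : ∀ {x} → Eigenspace (laplacian b) μ x → CoreHarmonic x
  eigen⇒coreHarmonic {x} eig i i<l₂ = +-identityʳ-unique (μ * x i) _ (begin
    μ * x i + coreLaplacian x i               ≡⟨ front-row (eigen-vanishes-on-tail eig) (ℕ.<-trans i<l₂ l₂<l₁) ⟨
    Σℚ (λ j → adjMatrix b i j * (x i - x j))  ≡⟨ laplacian-row b x i ⟨
    mulVec (laplacian b) x i                  ≡⟨ eig i ⟩
    μ * x i                                   ∎)

  coreHarmonic-neg : ∀ {x} → CoreHarmonic x → CoreHarmonic (λ j → - x j)
  coreHarmonic-neg {x} harmonic i i<l₂ = trans (coreLaplacian-neg x i) (cong -_ (harmonic i i<l₂))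

  core-argmax : (f : Fin n → ℚ) → ∃ λ i → toℕ i < l₂ × ∀ j → toℕ j < l₂ → f j ℚ.≤ f i
  core-argmax f = argmax f hub cores
                , argmax-all f {P = λ j → toℕ j < l₂} hub<l₂ (all-filter (λ j → toℕ j ℕ.<? l₂) (allFin n))
                , λ j j<l₂ → All.lookup (f[xs]≤f[argmax] hub cores) (∈-filter⁺ _ (∈-allFin j) j<l₂)
    where
    cores : List (Fin n)
    cores = filter (λ j → toℕ j ℕ.<? l₂) (allFin n)

  -- Maximum principle: at a maximiser i of x on the core no term of the harmonic sum is
  -- negative, and the term of the hub, which is adjacent to i, is x i − x hub.
  coreHarmonic⇒≤hub : ∀ {x} → CoreHarmonic x → ∀ j → toℕ j < l₂ → x j ℚ.≤ x hub
  coreHarmonic⇒≤hub {x} harmonic j j<l₂ with core-argmax x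
  ... | i , i<l₂ , maximal = ℚ.≤-trans (maximal j j<l₂) xᵢ≤x-hub
    where
    term : Fin n → ℚ
    term k = χ-core k * (adjMatrix b i k * (x i - x k))
    term-nonNeg : ∀ k → 0ℚ ℚ.≤ term k
    term-nonNeg k = indicator-weighted-nonNeg (toℕ k <ᵇ l₂) λ k<l₂ →
      indicator-weighted-nonNeg (thrAdj b i k) λ _ → 0≤p-q (maximal k (ℕ.<ᵇ⇒< _ _ k<l₂))
    xᵢ≤x-hub : x i ℚ.≤ x hub
    xᵢ≤x-hub with toℕ i ℕ.<? toℕ hub
    ... | yes i<hub = p-q≤0⇒p≤q (ℚ.≤-trans (ℚ.≤-reflexive term-hub)
                        (ℚ.≤-trans (term≤Σ term term-nonNeg hub) (ℚ.≤-reflexive (harmonic i i<l₂))))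
      where
      term-hub : x i - x hub ≡ term hub
      term-hub = sym (begin
        χ-core hub * (adjMatrix b i hub * (x i - x hub))  ≡⟨ cong₂ (λ c a → c * (a * (x i - x hub)))
                                                               (below-< hub<l₂) (hub-adjacent i<hub) ⟩
        1ℚ * (1ℚ * (x i - x hub))                         ≡⟨ ℚ.*-identityˡ _ ⟩
        1ℚ * (x i - x hub)                                ≡⟨ ℚ.*-identityˡ _ ⟩
        x i - x hub                                       ∎)
    ... | no i≮hub = ℚ.≤-reflexive (cong x (Fin.toℕ-injective
                       (ℕ.≤-antisym (ℕ.s≤s⁻¹ (subst (suc (toℕ i) ≤_) (sym suc-hub) i<l₂)) (ℕ.≮⇒≥ i≮hub))))

  coreHarmonic⇒constant : ∀ {x} → CoreHarmonic x → ∀ j → toℕ j < l₂ → x j ≡ x hub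
  coreHarmonic⇒constant {x} harmonic j j<l₂ = ℚ.≤-antisym
    (coreHarmonic⇒≤hub harmonic j j<l₂)
    (neg-cancel-≤ (coreHarmonic⇒≤hub (coreHarmonic-neg {x} harmonic) j j<l₂))

  eigen⇒admissible : ∀ {x} → Eigenspace (laplacian b) μ x → Admissible x
  eigen⇒admissible eig = record
    { vanishes-on-tail = eigen-vanishes-on-tail eig
    ; constant-on-core = coreHarmonic⇒constant (eigen⇒coreHarmonic eig)
    ; sum≡0            = eigenvector-sum≡0 b μ≢0 eig
    }

  admissible-block-sum : ∀ {x} → Admissible x → Σℚ (λ j → χ-block j * x j) ≡ - (ℕtoℚ l₂ * x hub)
  admissible-block-sum {x} adm = +-inverseʳ-unique (ℕtoℚ l₂ * x hub) (Σℚ on-block) (begin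
    ℕtoℚ l₂ * x hub + Σℚ on-block               ≡⟨ cong (λ s → s * x hub + Σℚ on-block) (Σ-below (ℕ.<⇒≤ l₂<n)) ⟨
    Σℚ χ-core * x hub + Σℚ on-block             ≡⟨ cong (_+ Σℚ on-block) (Σ-*ʳ (x hub) χ-core) ⟨
    Σℚ (λ j → χ-core j * x hub) + Σℚ on-block   ≡⟨ Σ-+ (λ j → χ-core j * x hub) on-block ⟨
    Σℚ (λ j → χ-core j * x hub + on-block j)    ≡⟨ Σ-cong split ⟨
    Σℚ x                                        ≡⟨ Admissible.sum≡0 adm ⟩
    0ℚ                                          ∎)
    where
    on-block : Fin n → ℚ
    on-block j = χ-block j * x j
    split : ∀ j → x j ≡ χ-core j * x hub + on-block j
    split j with region j
    ... | core j<l₂ = sym (begin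
      χ-core j * x hub + χ-block j * x j  ≡⟨ cong₂ (λ c d → c * x hub + d * x j) (below-< j<l₂) (χ-block-core j<l₂) ⟩
      1ℚ * x hub + 0ℚ * x j               ≡⟨ cong₂ _+_ (ℚ.*-identityˡ (x hub)) (ℚ.*-zeroˡ (x j)) ⟩
      x hub + 0ℚ                          ≡⟨ ℚ.+-identityʳ (x hub) ⟩
      x hub                               ≡⟨ Admissible.constant-on-core adm j j<l₂ ⟨
      x j                                 ∎)
    ... | block l₂≤j j<l₁ = sym (begin
      χ-core j * x hub + χ-block j * x j  ≡⟨ cong₂ (λ c d → c * x hub + d * x j)
                                               (below-≥ l₂≤j) (χ-block-block l₂≤j j<l₁) ⟩
      0ℚ * x hub + 1ℚ * x j               ≡⟨ cong₂ _+_ (ℚ.*-zeroˡ (x hub)) (ℚ.*-identityˡ (x j)) ⟩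
      0ℚ + x j                            ≡⟨ ℚ.+-identityˡ (x j) ⟩
      x j                                 ∎)
    ... | tail l₁≤j = sym (begin
      χ-core j * x hub + χ-block j * x j  ≡⟨ cong₂ (λ c d → c * x hub + d * x j)
                                               (below-≥ (ℕ.≤-trans (ℕ.<⇒≤ l₂<l₁) l₁≤j)) (χ-block-tail l₁≤j) ⟩
      0ℚ * x hub + 0ℚ * x j               ≡⟨ cong₂ _+_ (ℚ.*-zeroˡ (x hub)) (ℚ.*-zeroˡ (x j)) ⟩
      0ℚ                                  ≡⟨ Admissible.vanishes-on-tail adm j l₁≤j ⟨
      x j                                 ∎)

  admissible-linComb : ∀ {k} (vs : Fin k → Fin n → ℚ) → (∀ a → Admissible (vs a)) → ∀ c →
                       Admissible (linComb vs c)
  admissible-linComb {k} vs adm c = record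
    { vanishes-on-tail = λ j l₁≤j → trans
        (Σ-cong (λ a → trans (cong (c a *_) (Admissible.vanishes-on-tail (adm a) j l₁≤j)) (ℚ.*-zeroʳ (c a))))
        (Σ-zero k)
    ; constant-on-core = λ j j<l₂ → Σ-cong (λ a → cong (c a *_) (Admissible.constant-on-core (adm a) j j<l₂))
    ; sum≡0 = begin
        Σℚ (λ j → Σℚ (λ a → c a * vs a j))  ≡⟨ Σ-comm (λ j a → c a * vs a j) ⟩
        Σℚ (λ a → Σℚ (λ j → c a * vs a j))  ≡⟨ Σ-cong (λ a → Σ-*ˡ (c a) (vs a)) ⟩
        Σℚ (λ a → c a * Σℚ (vs a))          ≡⟨ Σ-cong (λ a → trans (cong (c a *_) (Admissible.sum≡0 (adm a)))
                                                                   (ℚ.*-zeroʳ (c a))) ⟩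
        Σℚ {k} (λ _ → 0ℚ)                   ≡⟨ Σ-zero k ⟩
        0ℚ                                  ∎
    }

  admissible-− : ∀ {x y} → Admissible x → Admissible y → Admissible (λ j → x j - y j)
  admissible-− {x} {y} adm-x adm-y = record
    { vanishes-on-tail = λ j l₁≤j → cong₂ _-_ (Admissible.vanishes-on-tail adm-x j l₁≤j)
                                              (Admissible.vanishes-on-tail adm-y j l₁≤j)
    ; constant-on-core = λ j j<l₂ → cong₂ _-_ (Admissible.constant-on-core adm-x j j<l₂)
                                              (Admissible.constant-on-core adm-y j j<l₂)
    ; sum≡0 = trans (Σ-− x y) (cong₂ _-_ (Admissible.sum≡0 adm-x) (Admissible.sum≡0 adm-y))
    }

  admissible-vanishes : ∀ {z} → Admissible z → z hub ≡ 0ℚ →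
                         (∀ j → l₂ < toℕ j → toℕ j < l₁ → z j ≡ 0ℚ) → ∀ j → z j ≡ 0ℚ
  admissible-vanishes {z} adm z-hub≡0 beyond-block₀ j with region j
  ... | core j<l₂ = trans (Admissible.constant-on-core adm j j<l₂) z-hub≡0
  ... | tail l₁≤j = Admissible.vanishes-on-tail adm j l₁≤j
  ... | block l₂≤j j<l₁ with l₂ ℕ.≟ toℕ j
  ...   | no l₂≢j = beyond-block₀ j (ℕ.≤∧≢⇒< l₂≤j l₂≢j) j<l₁
  ...   | yes l₂≡j = begin
    z j                                ≡⟨ ℚ.*-identityˡ (z j) ⟨
    1ℚ * z j                           ≡⟨ cong (_* z j) (χ-block-block l₂≤j j<l₁) ⟨
    χ-block j * z j                    ≡⟨ Σ-single (λ i → χ-block i * z i) j off-block₀ ⟨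
    Σℚ (λ i → χ-block i * z i)         ≡⟨ admissible-block-sum adm ⟩
    - (ℕtoℚ l₂ * z hub)                ≡⟨ cong (λ w → - (ℕtoℚ l₂ * w)) z-hub≡0 ⟩
    - (ℕtoℚ l₂ * 0ℚ)                   ≡⟨ cong -_ (ℚ.*-zeroʳ (ℕtoℚ l₂)) ⟩
    0ℚ                                 ∎
    where
    off-block₀ : ∀ i → i ≢ j → χ-block i * z i ≡ 0ℚ
    off-block₀ i i≢j with region i
    ... | core i<l₂ = trans (cong (_* z i) (χ-block-core i<l₂)) (ℚ.*-zeroˡ (z i))
    ... | tail l₁≤i = trans (cong (_* z i) (χ-block-tail l₁≤i)) (ℚ.*-zeroˡ (z i))
    ... | block l₂≤i i<l₁ = trans (cong (χ-block i *_) (beyond-block₀ i l₂<i i<l₁)) (ℚ.*-zeroʳ (χ-block i))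
      where
      l₂<i : l₂ < toℕ i
      l₂<i = ℕ.≤∧≢⇒< l₂≤i (λ l₂≡i → i≢j (Fin.toℕ-injective (trans (sym l₂≡i) l₂≡j)))

  test-vector : Fin n → ℚ
  test-vector j = ℕtoℚ l₁ * χ-core j - ℕtoℚ l₂ * χ-front j

  test-vector-core : ∀ {j} → toℕ j < l₂ → test-vector j ≡ ℕtoℚ l₁ * 1ℚ - ℕtoℚ l₂ * 1ℚ
  test-vector-core j<l₂ = cong₂ (λ c d → ℕtoℚ l₁ * c - ℕtoℚ l₂ * d) (below-< j<l₂) (below-< (ℕ.<-trans j<l₂ l₂<l₁))

  test-vector-admissible : Admissible test-vector
  test-vector-admissible = record
    { vanishes-on-tail = λ j l₁≤j → begin
        test-vector j                       ≡⟨ cong₂ (λ c d → ℕtoℚ l₁ * c - ℕtoℚ l₂ * d)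
                                                 (below-≥ (ℕ.≤-trans (ℕ.<⇒≤ l₂<l₁) l₁≤j)) (below-≥ l₁≤j) ⟩
        ℕtoℚ l₁ * 0ℚ - ℕtoℚ l₂ * 0ℚ         ≡⟨ cong₂ _-_ (ℚ.*-zeroʳ (ℕtoℚ l₁)) (ℚ.*-zeroʳ (ℕtoℚ l₂)) ⟩
        0ℚ                                  ∎
    ; constant-on-core = λ j j<l₂ → trans (test-vector-core j<l₂) (sym (test-vector-core hub<l₂))
    ; sum≡0 = begin
        Σℚ test-vector
          ≡⟨ Σ-− (λ j → ℕtoℚ l₁ * χ-core j) (λ j → ℕtoℚ l₂ * χ-front j) ⟩
        Σℚ (λ j → ℕtoℚ l₁ * χ-core j) - Σℚ (λ j → ℕtoℚ l₂ * χ-front j)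
          ≡⟨ cong₂ _-_ (Σ-*ˡ (ℕtoℚ l₁) χ-core) (Σ-*ˡ (ℕtoℚ l₂) χ-front) ⟩
        ℕtoℚ l₁ * Σℚ χ-core - ℕtoℚ l₂ * Σℚ χ-front
          ≡⟨ cong₂ (λ s t → ℕtoℚ l₁ * s - ℕtoℚ l₂ * t) (Σ-below (ℕ.<⇒≤ l₂<n)) (Σ-below (ℕ.<⇒≤ l₁<n)) ⟩
        ℕtoℚ l₁ * ℕtoℚ l₂ - ℕtoℚ l₂ * ℕtoℚ l₁
          ≡⟨ cong (λ s → s - ℕtoℚ l₂ * ℕtoℚ l₁) (ℚ.*-comm (ℕtoℚ l₁) (ℕtoℚ l₂)) ⟩
        ℕtoℚ l₂ * ℕtoℚ l₁ - ℕtoℚ l₂ * ℕtoℚ l₁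
          ≡⟨ ℚ.+-inverseʳ (ℕtoℚ l₂ * ℕtoℚ l₁) ⟩
        0ℚ
          ∎
    }

  test-vector-hub≢0 : test-vector hub ≢ 0ℚ
  test-vector-hub≢0 y-hub≡0 = ℕ.<⇒≢ l₂<l₁ (sym (ℕtoℚ-injective (begin
    ℕtoℚ l₁         ≡⟨ ℚ.*-identityʳ (ℕtoℚ l₁) ⟨
    ℕtoℚ l₁ * 1ℚ    ≡⟨ x∙y⁻¹≈ε⇒x≈y _ _ (trans (sym (test-vector-core hub<l₂)) y-hub≡0) ⟩
    ℕtoℚ l₂ * 1ℚ    ≡⟨ ℚ.*-identityʳ (ℕtoℚ l₂) ⟩
    ℕtoℚ l₂         ∎)))

  trit-admissible⇒l₂+l₂≤l₁ : ∀ {v} → (∀ j → Trit (v j)) → Admissible v → v hub ≢ 0ℚ → l₂ ℕ.+ l₂ ≤ l₁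
  trit-admissible⇒l₂+l₂≤l₁ {v} trit adm σ≢0 = ℕtoℚ-cancel-≤
    (subst₂ ℚ._≤_ (sym (ℕtoℚ-+ l₂ l₂)) (p-q+q≡p (ℕtoℚ l₁) (ℕtoℚ l₂)) (ℚ.+-monoˡ-≤ (ℕtoℚ l₂) l₂≤l₁-l₂))
    where
    σ : ℚ
    σ = v hub
    weighted : Fin n → ℚ
    weighted j = χ-block j * - (σ * v j)
    Σweighted≡l₂ : Σℚ weighted ≡ ℕtoℚ l₂
    Σweighted≡l₂ = begin
      Σℚ weighted                              ≡⟨ Σ-cong (λ j → solve 3 (λ c s w → c :* (:- (s :* w)) := :- s :* (c :* w))
                                                                    refl (χ-block j) σ (v j)) ⟩
      Σℚ (λ j → - σ * (χ-block j * v j))       ≡⟨ Σ-*ˡ (- σ) (λ j → χ-block j * v j) ⟩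
      - σ * Σℚ (λ j → χ-block j * v j)         ≡⟨ cong (- σ *_) (admissible-block-sum adm) ⟩
      - σ * - (ℕtoℚ l₂ * σ)                    ≡⟨ solve 2 (λ s l → :- s :* (:- (l :* s)) := l :* (s :* s))
                                                          refl σ (ℕtoℚ l₂) ⟩
      ℕtoℚ l₂ * (σ * σ)                        ≡⟨ cong (ℕtoℚ l₂ *_) (Trit-square (trit hub) σ≢0) ⟩
      ℕtoℚ l₂ * 1ℚ                             ≡⟨ ℚ.*-identityʳ (ℕtoℚ l₂) ⟩
      ℕtoℚ l₂                                  ∎
    weighted≤χ-block : ∀ j → weighted j ℚ.≤ χ-block j
    weighted≤χ-block j with region j
    ... | core j<l₂ = ℚ.≤-reflexive (trans (cong (_* - (σ * v j)) (χ-block-core j<l₂))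
                        (trans (ℚ.*-zeroˡ (- (σ * v j))) (sym (χ-block-core j<l₂))))
    ... | block l₂≤j j<l₁ = subst₂ ℚ._≤_
      (trans (sym (ℚ.*-identityˡ (- (σ * v j)))) (cong (_* - (σ * v j)) (sym (χ-block-block l₂≤j j<l₁))))
      (sym (χ-block-block l₂≤j j<l₁))
      (neg-Trit-product≤1 (trit hub) (trit j))
    ... | tail l₁≤j = ℚ.≤-reflexive (trans (cong (_* - (σ * v j)) (χ-block-tail l₁≤j))
                        (trans (ℚ.*-zeroˡ (- (σ * v j))) (sym (χ-block-tail l₁≤j))))
    Σχ-block : Σℚ χ-block ≡ ℕtoℚ l₁ - ℕtoℚ l₂
    Σχ-block = trans (Σ-− χ-front χ-core) (cong₂ _-_ (Σ-below (ℕ.<⇒≤ l₁<n)) (Σ-below (ℕ.<⇒≤ l₂<n)))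
    l₂≤l₁-l₂ : ℕtoℚ l₂ ℚ.≤ ℕtoℚ l₁ - ℕtoℚ l₂
    l₂≤l₁-l₂ = subst₂ ℚ._≤_ Σweighted≡l₂ Σχ-block (Σ-mono-≤ weighted≤χ-block)

  simplyStructured⇒l₂+l₂≤l₁ : SimplyStructured (Eigenspace (laplacian b) μ) → l₂ ℕ.+ l₂ ≤ l₁
  simplyStructured⇒l₂+l₂≤l₁ (k , vs , trit , in-eigenspace , _ , spans)
    with spans test-vector (admissible⇒eigen test-vector-admissible)
  ... | c , y≡Σcv = nonzero-at-hub (Fin.¬∀⟶∃¬ k (λ a → vs a hub ≡ 0ℚ) (λ a → vs a hub ℚ.≟ 0ℚ) all-vanish-at-hub)
    where
    nonzero-at-hub : (∃ λ a → vs a hub ≢ 0ℚ) → l₂ ℕ.+ l₂ ≤ l₁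
    nonzero-at-hub (a , vₐ-hub≢0) = trit-admissible⇒l₂+l₂≤l₁ (trit a) (eigen⇒admissible (in-eigenspace a)) vₐ-hub≢0
    all-vanish-at-hub : ¬ (∀ a → vs a hub ≡ 0ℚ)
    all-vanish-at-hub vanish = test-vector-hub≢0 (begin
      test-vector hub                   ≡⟨ y≡Σcv hub ⟩
      Σℚ (λ a → c a * vs a hub)         ≡⟨ Σ-cong (λ a → trans (cong (c a *_) (vanish a)) (ℚ.*-zeroʳ (c a))) ⟩
      Σℚ {k} (λ _ → 0ℚ)                 ≡⟨ Σ-zero k ⟩
      0ℚ                                ∎)

  module _ (l₂+l₂≤l₁ : l₂ ℕ.+ l₂ ≤ l₁) where

    -- 1 on the core, −1 on the next l₂ vertices, 0 beyond.
    balancing : Fin n → ℚ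
    balancing j = (χ-core j + χ-core j) - below (l₂ ℕ.+ l₂) (toℕ j)

    balancing-core : ∀ {j} → toℕ j < l₂ → balancing j ≡ 1ℚ
    balancing-core j<l₂ = cong₂ (λ c d → (c + c) - d) (below-< j<l₂) (below-< (ℕ.<-≤-trans j<l₂ (ℕ.m≤m+n l₂ l₂)))

    balancing-far : ∀ {j} → l₂ ℕ.+ l₂ ≤ toℕ j → balancing j ≡ 0ℚ
    balancing-far far = cong₂ (λ c d → (c + c) - d) (below-≥ (ℕ.≤-trans (ℕ.m≤m+n l₂ l₂) far)) (below-≥ far)

    balancing-trit : ∀ j → Trit (balancing j)
    balancing-trit j with toℕ j ℕ.<? l₂ | toℕ j ℕ.<? l₂ ℕ.+ l₂
    ... | yes j<l₂ | _     = subst Trit (sym (balancing-core j<l₂)) (inj₂ (inj₂ refl))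
    ... | no j≮l₂  | yes near =
      subst Trit (sym (cong₂ (λ c d → (c + c) - d) (below-≥ (ℕ.≮⇒≥ j≮l₂)) (below-< near))) (inj₁ refl)
    ... | no _     | no far = subst Trit (sym (balancing-far (ℕ.≮⇒≥ far))) (inj₂ (inj₁ refl))

    balancing-admissible : Admissible balancing
    balancing-admissible = record
      { vanishes-on-tail = λ j l₁≤j → balancing-far (ℕ.≤-trans l₂+l₂≤l₁ l₁≤j)
      ; constant-on-core = λ j j<l₂ → trans (balancing-core j<l₂) (sym (balancing-core hub<l₂))
      ; sum≡0 = begin
          Σℚ balancing
            ≡⟨ Σ-− (λ j → χ-core j + χ-core j) (λ (j : Fin n) → below (l₂ ℕ.+ l₂) (toℕ j)) ⟩
          Σℚ (λ j → χ-core j + χ-core j) - Σℚ (λ (j : Fin n) → below (l₂ ℕ.+ l₂) (toℕ j))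
            ≡⟨ cong₂ _-_ (Σ-+ χ-core χ-core) (Σ-below (ℕ.≤-trans l₂+l₂≤l₁ (ℕ.<⇒≤ l₁<n))) ⟩
          (Σℚ χ-core + Σℚ χ-core) - ℕtoℚ (l₂ ℕ.+ l₂)
            ≡⟨ cong₂ (λ s t → (s + s) - t) (Σ-below (ℕ.<⇒≤ l₂<n)) (ℕtoℚ-+ l₂ l₂) ⟩
          (ℕtoℚ l₂ + ℕtoℚ l₂) - (ℕtoℚ l₂ + ℕtoℚ l₂)
            ≡⟨ ℚ.+-inverseʳ (ℕtoℚ l₂ + ℕtoℚ l₂) ⟩
          0ℚ
            ∎
      }

    -- block₀ is the paper's vertex l₂ + 1; the pivots are the other block vertices.
    block₀ : Fin n
    block₀ = fromℕ< l₂<n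

    k : ℕ
    k = l₁ ∸ suc l₂

    pivot<l₁ : (s : Fin k) → suc (l₂ ℕ.+ toℕ s) < l₁
    pivot<l₁ s = subst (suc (l₂ ℕ.+ toℕ s) <_) (ℕ.m+[n∸m]≡n l₂<l₁) (ℕ.+-monoʳ-< (suc l₂) (Fin.toℕ<n s))

    pivot : Fin k → Fin n
    pivot s = fromℕ< (ℕ.<-trans (pivot<l₁ s) l₁<n)

    toℕ-pivot : ∀ s → toℕ (pivot s) ≡ suc (l₂ ℕ.+ toℕ s)
    toℕ-pivot s = Fin.toℕ-fromℕ< _

    pivot-onto : ∀ j → l₂ < toℕ j → toℕ j < l₁ → ∃ λ s → pivot s ≡ j
    pivot-onto j l₂<j j<l₁ = s , Fin.toℕ-injective (begin
      toℕ (pivot s)                 ≡⟨ toℕ-pivot s ⟩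
      suc l₂ ℕ.+ toℕ s              ≡⟨ cong (suc l₂ ℕ.+_) (Fin.toℕ-fromℕ< _) ⟩
      suc l₂ ℕ.+ (toℕ j ∸ suc l₂)   ≡⟨ ℕ.m+[n∸m]≡n l₂<j ⟩
      toℕ j                         ∎)
      where
      s : Fin k
      s = fromℕ< (ℕ.∸-monoˡ-< j<l₁ l₂<j)

    transfer : Fin k → Fin n → ℚ
    transfer s j = unit (pivot s) j - unit block₀ j

    transfer-off : ∀ s {j} → toℕ j ≢ l₂ → toℕ j ≢ toℕ (pivot s) → transfer s j ≡ 0ℚ
    transfer-off s j≢l₂ j≢pivot = cong₂ _-_
      (unit-≢ (λ pivot≡j → j≢pivot (cong toℕ (sym pivot≡j))))
      (unit-≢ (λ block₀≡j → j≢l₂ (trans (cong toℕ (sym block₀≡j)) (Fin.toℕ-fromℕ< l₂<n))))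

    pivot>l₂ : ∀ s → l₂ < toℕ (pivot s)
    pivot>l₂ s = subst (l₂ <_) (sym (toℕ-pivot s)) (s≤s (ℕ.m≤m+n l₂ (toℕ s)))

    transfer-pivot : ∀ s → transfer s (pivot s) ≡ 1ℚ
    transfer-pivot s = cong₂ _-_ (unit-≡ (pivot s))
      (unit-≢ (λ block₀≡pivot → ℕ.<⇒≢ (pivot>l₂ s) (trans (sym (Fin.toℕ-fromℕ< l₂<n)) (cong toℕ block₀≡pivot))))

    transfer-core : ∀ s {j} → toℕ j < l₂ → transfer s j ≡ 0ℚ
    transfer-core s j<l₂ = transfer-off s (ℕ.<⇒≢ j<l₂) (ℕ.<⇒≢ (ℕ.<-trans j<l₂ (pivot>l₂ s)))

    transfer-admissible : ∀ s → Admissible (transfer s)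
    transfer-admissible s = record
      { vanishes-on-tail = λ j l₁≤j → transfer-off s
          (ℕ.<⇒≢ (ℕ.<-≤-trans l₂<l₁ l₁≤j) ∘ sym)
          (ℕ.<⇒≢ (ℕ.<-≤-trans (subst (_< l₁) (sym (toℕ-pivot s)) (pivot<l₁ s)) l₁≤j) ∘ sym)
      ; constant-on-core = λ j j<l₂ → trans (transfer-core s j<l₂) (sym (transfer-core s hub<l₂))
      ; sum≡0 = trans (Σ-− (unit (pivot s)) (unit block₀)) (cong₂ _-_ (Σ-unit (pivot s)) (Σ-unit block₀))
      }

    basis : Fin (suc k) → Fin n → ℚ
    basis zero    = balancing
    basis (suc s) = transfer s

    basis-trit : ∀ a j → Trit (basis a j)
    basis-trit zero    j = balancing-trit j
    basis-trit (suc s) j = Trit-unit-difference (pivot s) block₀ j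

    basis-admissible : ∀ a → Admissible (basis a)
    basis-admissible zero    = balancing-admissible
    basis-admissible (suc s) = transfer-admissible s

    linComb-basis-hub : ∀ c → linComb basis c hub ≡ c zero
    linComb-basis-hub c = begin
      c zero * balancing hub + Σℚ (λ s → c (suc s) * transfer s hub)
        ≡⟨ cong₂ (λ w v → c zero * w + v) (balancing-core hub<l₂)
             (Σ-cong (λ s → trans (cong (c (suc s) *_) (transfer-core s hub<l₂)) (ℚ.*-zeroʳ (c (suc s))))) ⟩
      c zero * 1ℚ + Σℚ {k} (λ _ → 0ℚ)  ≡⟨ cong₂ _+_ (ℚ.*-identityʳ (c zero)) (Σ-zero k) ⟩
      c zero + 0ℚ                      ≡⟨ ℚ.+-identityʳ (c zero) ⟩
      c zero                           ∎

    linComb-basis-pivot : ∀ c s → linComb basis c (pivot s) ≡ c zero * balancing (pivot s) + c (suc s)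
    linComb-basis-pivot c s = cong (c zero * balancing (pivot s) +_) (begin
      Σℚ (λ s′ → c (suc s′) * transfer s′ (pivot s))  ≡⟨ Σ-single _ s others ⟩
      c (suc s) * transfer s (pivot s)                 ≡⟨ cong (c (suc s) *_) (transfer-pivot s) ⟩
      c (suc s) * 1ℚ                                   ≡⟨ ℚ.*-identityʳ (c (suc s)) ⟩
      c (suc s)                                        ∎)
      where
      others : ∀ s′ → s′ ≢ s → c (suc s′) * transfer s′ (pivot s) ≡ 0ℚ
      others s′ s′≢s = trans (cong (c (suc s′) *_) (transfer-off s′ (ℕ.<⇒≢ (pivot>l₂ s) ∘ sym) pivots-differ))
                             (ℚ.*-zeroʳ (c (suc s′)))
        where
        pivots-differ : toℕ (pivot s) ≢ toℕ (pivot s′)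
        pivots-differ eq = s′≢s (sym (Fin.toℕ-injective (ℕ.+-cancelˡ-≡ l₂ _ _
          (ℕ.suc-injective (trans (sym (toℕ-pivot s)) (trans eq (toℕ-pivot s′)))))))

    basis-independent : LinearlyIndependent basis
    basis-independent c linComb≡0 = coefficient≡0
      where
      c₀≡0 : c zero ≡ 0ℚ
      c₀≡0 = trans (sym (linComb-basis-hub c)) (linComb≡0 hub)
      coefficient≡0 : ∀ a → c a ≡ 0ℚ
      coefficient≡0 zero    = c₀≡0
      coefficient≡0 (suc s) = begin
        c (suc s)                                  ≡⟨ ℚ.+-identityˡ (c (suc s)) ⟨
        0ℚ + c (suc s)                             ≡⟨ cong (_+ c (suc s)) (ℚ.*-zeroˡ (balancing (pivot s))) ⟨
        0ℚ * balancing (pivot s) + c (suc s)       ≡⟨ cong (λ w → w * balancing (pivot s) + c (suc s)) c₀≡0 ⟨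
        c zero * balancing (pivot s) + c (suc s)   ≡⟨ linComb-basis-pivot c s ⟨
        linComb basis c (pivot s)                  ≡⟨ linComb≡0 (pivot s) ⟩
        0ℚ                                         ∎

    coordinates : (Fin n → ℚ) → Fin (suc k) → ℚ
    coordinates x zero    = x hub
    coordinates x (suc s) = x (pivot s) - x hub * balancing (pivot s)

    basis-spans : ∀ {x} → Admissible x → ∀ j → x j ≡ linComb basis (coordinates x) j
    basis-spans {x} adm j = x∙y⁻¹≈ε⇒x≈y _ _
      (admissible-vanishes residual-admissible residual-hub residual-beyond-block₀ j)
      where
      residual : Fin n → ℚ
      residual i = x i - linComb basis (coordinates x) i
      residual-admissible : Admissible residual
      residual-admissible = admissible-− adm (admissible-linComb basis basis-admissible (coordinates x))
      residual-hub : residual hub ≡ 0ℚ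
      residual-hub = trans (cong (λ w → x hub - w) (linComb-basis-hub (coordinates x))) (ℚ.+-inverseʳ (x hub))
      residual-pivot : ∀ s → residual (pivot s) ≡ 0ℚ
      residual-pivot s = trans (cong (λ w → q - w) (trans (linComb-basis-pivot (coordinates x) s)
                                 (trans (ℚ.+-comm a (q - a)) (p-q+q≡p q a))))
                               (ℚ.+-inverseʳ q)
        where
        q a : ℚ
        q = x (pivot s)
        a = x hub * balancing (pivot s)
      residual-beyond-block₀ : ∀ i → l₂ < toℕ i → toℕ i < l₁ → residual i ≡ 0ℚ
      residual-beyond-block₀ i l₂<i i<l₁ with pivot-onto i l₂<i i<l₁
      ... | s , refl = residual-pivot s

    l₂+l₂≤l₁⇒simplyStructured : SimplyStructured (Eigenspace (laplacian b) μ)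
    l₂+l₂≤l₁⇒simplyStructured =
      suc k , basis , basis-trit , (λ a → admissible⇒eigen (basis-admissible a)) , basis-independent ,
      λ x eig → coordinates x , basis-spans (eigen⇒admissible eig)

m*2≡m+m : ∀ m → m ℕ.* 2 ≡ m ℕ.+ m
m*2≡m+m m = trans (ℕ.*-comm m 2) (cong (m ℕ.+_) (ℕ.+-identityʳ m))

≤/2⇔+≤ : ∀ m l → m ≤ l / 2 ⇔ m ℕ.+ m ≤ l
≤/2⇔+≤ m l = mk⇔
  (λ m≤l/2 → subst (_≤ l) (m*2≡m+m m) (ℕ.≤-trans (ℕ.*-monoˡ-≤ 2 m≤l/2) (ℕ.m/n*n≤m l 2)))
  (λ m+m≤l → subst (_≤ l / 2) (ℕ.m*n/n≡m m 2) (ℕ./-monoˡ-≤ 2 (subst (_≤ l) (sym (m*2≡m+m m)) m+m≤l)))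

≤∸1⇒< : ∀ {m l} → 1 ≤ m → m ≤ l ∸ 1 → m < l
≤∸1⇒< {l = suc l} _       m≤l = s≤s m≤l
≤∸1⇒< {l = zero}  (s≤s _) ()

bit-lookup : ∀ {n} (b : Vec Bool n) (j : Fin n) → bit b (suc (toℕ j)) ≡ lookup b j
bit-lookup {n} b j with toℕ j ℕ.<? n
... | yes j<n = cong (lookup b) (Fin.fromℕ<-toℕ j j<n)
... | no j≮n  = contradiction (Fin.toℕ<n j) j≮n

thresholdShape : ∀ {n} (b : Vec Bool n) {l₁ l₂} →
  1 ≤ l₁ → l₁ ≤ n ∸ 1 →
  bit b l₁ ≡ false →
  (∀ j → suc l₁ ≤ j → j ≤ n → bit b j ≡ true) →
  2 ≤ l₂ → l₂ ≤ l₁ ∸ 1 →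
  (∀ j → suc l₂ ≤ j → j ≤ l₁ → bit b j ≡ bit b l₁) →
  bit b l₂ ≢ bit b (suc l₂) →
  ThresholdShape b l₁ l₂
thresholdShape b {l₁} {l₂} 1≤l₁ l₁≤n-1 b[l₁]≡0 tail-ones 2≤l₂ l₂≤l₁-1 block-constant b[l₂]≢b[l₂+1] = record
  { 0<l₂            = 0<l₂
  ; l₂<l₁           = l₂<l₁
  ; l₁<n            = ≤∸1⇒< 1≤l₁ l₁≤n-1
  ; hub-dominating  = λ j suc-j≡l₂ → begin
      lookup b j               ≡⟨ bit-lookup b j ⟨
      bit b (suc (toℕ j))      ≡⟨ cong (bit b) suc-j≡l₂ ⟩
      bit b l₂                 ≡⟨ ¬-not b[l₂]≢b[l₂+1] ⟩
      not (bit b (suc l₂))     ≡⟨ cong not (trans (block-constant (suc l₂) ℕ.≤-refl l₂<l₁) b[l₁]≡0) ⟩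
      true                     ∎
  ; block-isolated  = λ j l₂≤j j<l₁ →
      trans (sym (bit-lookup b j)) (trans (block-constant (suc (toℕ j)) (s≤s l₂≤j) j<l₁) b[l₁]≡0)
  ; tail-dominating = λ j l₁≤j →
      trans (sym (bit-lookup b j)) (tail-ones (suc (toℕ j)) (s≤s l₁≤j) (Fin.toℕ<n j))
  }
  where
  0<l₂ : 0 < l₂
  0<l₂ = ℕ.≤-trans (s≤s z≤n) 2≤l₂
  l₂<l₁ : l₂ < l₁
  l₂<l₁ = ≤∸1⇒< 0<l₂ l₂≤l₁-1

proposition3p3 : (n : ℕ) (b : Vec Bool n) (l₁ l₂ : ℕ) →
    bit b 1 ≡ false →
    bit b n ≡ true →
    1 ≤ l₁ → l₁ ≤ n ∸ 1 →
    bit b l₁ ≡ false →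
    (∀ j → suc l₁ ≤ j → j ≤ n → bit b j ≡ true) →
    2 ≤ l₂ → l₂ ≤ l₁ ∸ 1 →
    (∀ j → suc l₂ ≤ j → j ≤ l₁ → bit b j ≡ bit b l₁) →
    bit b l₂ ≢ bit b (suc l₂) →
    SimplyStructured (Eigenspace (laplacian b) (ℕtoℚ (n ∸ l₁)))
      ⇔ (2 ≤ l₂ × l₂ ≤ l₁ / 2)
proposition3p3 n b l₁ l₂ _ _ 1≤l₁ l₁≤n-1 b[l₁]≡0 tail-ones 2≤l₂ l₂≤l₁-1 block-constant b[l₂]≢b[l₂+1] = mk⇔
  (λ simple → 2≤l₂ , from (simplyStructured⇒l₂+l₂≤l₁ shape simple))
  (λ (_ , l₂≤l₁/2) → l₂+l₂≤l₁⇒simplyStructured shape (to l₂≤l₁/2))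
  where
  shape : ThresholdShape b l₁ l₂
  shape = thresholdShape b 1≤l₁ l₁≤n-1 b[l₁]≡0 tail-ones 2≤l₂ l₂≤l₁-1 block-constant b[l₂]≢b[l₂+1]
  open Function.Equivalence (≤/2⇔+≤ l₂ l₁)
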